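{- For every sentence $\alpha\in\mathcal L_0^{[:=]}$ there is $\gamma\in\mathcal L^{[:=]}_{\mathtt{ANF}}$ such that $\vdash_{\mathbf{LEL}^{[:=]}}\alpha\leftrightarrow\gamma$.
   Context: Fix a nonempty finite set $\mathbf{A}$ of agents, a countable set $\mathbf{X}$ of variables with $\mathbf A\cap\mathbf X=\emptyset$, and a countable set $\mathbf{P}$ of predicate letters. Formulas of $\mathcal{L}^{[:=]}$ and free variables: $\phi ::= p_x \mid \top \mid \neg\phi \mid (\phi\wedge\phi) \mid [x:=a]\phi \mid \mathsf{K}_X\alpha$, with $p\in\mathbf P$, $x\in\mathbf X$, $a\in\mathbf A$, $X\subseteq\mathbf X$ finite (possibly empty), $\alpha$ a formula with no free variables; $FV(p_x)=\{x\}$, $FV(\top)=\emptyset$, $FV$ commutes with Booleans, $FV([x:=a]\phi)=FV(\phi)\setminus\{x\}$, $FV(\mathsf K_X\alpha)=X$. $\mathcal L_0^{[:=]}$ is the set of sentences (no free variables). Other Booleans as usual, $\bot:=\neg\top$, $\langle x:=a\rangle\phi:=\neg[x:=a]\neg\phi$. $\phi[y/x]$ replaces free occurrences of $x$ by $y$; admissible if $x$ has no free occurrence within the scope of any $[y:=b]$. For $\vec x=x_1,\dots,x_n$, $\vec a=a_1,\dots,a_n$: $[\vec x:=\vec a]\phi$ abbreviates $[x_1:=a_1]\cdots[x_n:=a_n]\phi$ (just $\phi$ if $n=0$), $\mathsf K_{\vec x}$ abbreviates $\mathsf K_{\{x_1,\dots,x_n\}}$, $\mathsf K_x=\mathsf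 K_{\{x\}}$. Assignment normal form: $\mathcal L^{[:=]}_{\mathtt{ANF}}\ni\gamma ::= [x:=a]p_x \mid [x:=a]\bot \mid \top \mid \neg\gamma \mid (\gamma\wedge\gamma) \mid [\vec x:=\vec a]\mathsf K_{\vec x}\gamma$. $\mathbf{LEL}^{[:=]}$: axioms: propositional tautologies; $\mathsf K_X(\alpha\to\beta)\to(\mathsf K_X\alpha\to\mathsf K_X\beta)$; $\mathsf K_X\alpha\to\mathsf K_Y\alpha$ ($X\subseteq Y$); $[x:=a](\phi\to\psi)\to([x:=a]\phi\to[x:=a]\psi)$; $\langle x:=a\rangle\phi\to[x:=a]\phi$; $\phi\to[x:=a]\phi$ ($x\notin FV(\phi)$); $[y:=a]([x:=a]\phi\to\phi[y/x])$ ($\phi[y/x]$ admissible); $[x:=a][y:=b]\phi\to[y:=b][x:=a]\phi$ ($x\neq y$); $\bigwedge_{a\in\mathbf A}[x:=a]\phi\to\phi$; $\mathsf K_X\alpha\to\alpha$; $[\vec x:=\vec a](\neg\mathsf K_{\vec x}\alpha\to\mathsf K_{\vec x}[\vec x:=\vec a]\neg\mathsf K_{\vec x}\alpha)$; $[x:=a]\mathsf K_x\langle x:=a\rangle\top$; $[x:=a](p_x\to\mathsf K_x[x:=a]p_x)$; $[\vec x:=\vec a](\bigwedge_{b\in B}[x:=b]\bot\to\mathsf K_{\vec x}\bigwedge_{b\in B}[x:=b]\bot)$ with $B=\mathbf A\setminus\{\vec a\}$. Rules: modus ponens; from $\alpha$ infer $\mathsf K_\emptyset\alpha$; from $\phi$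 infer $[x:=a]\phi$. -}

module Defs where

open import Data.Nat using (ℕ; suc)
open import Data.Fin using (Fin)
open import Data.Bool using (Bool; true; false; _∨_; _∧_; not; if_then_else_)
open import Data.List using (List; []; _∷_; map; filter; foldr)
open import Data.List.Membership.DecPropositional using ()
open import Data.List.Relation.Unary.Any using (any?)
open import Data.List.Relation.Binary.Subset.Propositional using (_⊆_)
open import Data.Product using (_×_; _,_; proj₁; proj₂)
open import Data.Empty using (⊥)
open import Data.Unit using (⊤)
open import Relation.Nullary using (¬_; does)
open import Relation.Binary.PropositionalEquality using (_≡_; _≢_; cong)
open import Relation.Binary.Definitions using (DecidableEquality)
open import Function.Bundles using (_↣_; Injection)
import Data.Nat.Properties as ℕP
import Data.Fin.Properties as FinP
import Data.Fin as F

-- The logic LEL^[:=], parameterised by: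
--   nA : agents are  A = Fin (suc nA)  (an arbitrary nonempty finite set),
--   X  : the variables, countable (witnessed by an injection into ℕ),
--   P  : the predicate letters, countable.
-- A and X are distinct types, hence disjoint.
module Logic (nA : ℕ) (X : Set) (cX : X ↣ ℕ) (P : Set) (cP : P ↣ ℕ) where

  Ag : Set
  Ag = Fin (suc nA)

  _≟X_ : DecidableEquality X
  x ≟X y with Injection.to cX x ℕP.≟ Injection.to cX y
  ... | Relation.Nullary.yes e = Relation.Nullary.yes (Injection.injective cX e)
  ... | Relation.Nullary.no ne = Relation.Nullary.no (λ e → ne (cong (Injection.to cX) e))

  eqX : X → X → Bool
  eqX x y = does (x ≟X y)

  memX : X → List X → Bool
  memX x xs = does (any? (x ≟X_) xs)

  memA : Ag → List Ag → Bool
  memA a as = does (any? (a F.≟_) as)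

  -- raw formulas; the index set of K is a finite list (read as a set)
  infixr 6 _∧'_
  data Form : Set where
    pr    : P → X → Form
    ⊤'    : Form
    ¬'    : Form → Form
    _∧'_  : Form → Form → Form
    [_≔_]_ : X → Ag → Form → Form
    K     : List X → Form → Form

  ⊥' : Form
  ⊥' = ¬' ⊤'

  infixr 4 _⇒_
  _⇒_ : Form → Form → Form
  φ ⇒ ψ = ¬' (φ ∧' ¬' ψ)

  _⇔_ : Form → Form → Form
  φ ⇔ ψ = (φ ⇒ ψ) ∧' (ψ ⇒ φ)

  ⟨_≔_⟩_ : X → Ag → Form → Form
  ⟨ x ≔ a ⟩ φ = ¬' ([ x ≔ a ] ¬' φ)

  ⋀ : List Form → Form
  ⋀ = foldr _∧'_ ⊤'

  assigns : List (X × Ag) → Form → Form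
  assigns [] φ = φ
  assigns ((x , a) ∷ σ) φ = [ x ≔ a ] assigns σ φ

  vars : List (X × Ag) → List X
  vars = map proj₁

  agents : List (X × Ag) → List Ag
  agents = map proj₂

  free : X → Form → Bool
  free x (pr p y) = eqX x y
  free x ⊤' = false
  free x (¬' φ) = free x φ
  free x (φ ∧' ψ) = free x φ ∨ free x ψ
  free x ([ y ≔ a ] φ) = if eqX x y then false else free x φ
  free x (K xs α) = memX x xs

  Closed : Form → Set
  Closed φ = ∀ x → free x φ ≡ false

  WF : Form → Set
  WF (pr p x) = ⊤
  WF ⊤' = ⊤
  WF (¬' φ) = WF φ
  WF (φ ∧' ψ) = WF φ × WF ψ
  WF ([ x ≔ a ] φ) = WF φ
  WF (K xs α) = Closed α × WF α

  Sentence : Form → Set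
  Sentence φ = Closed φ × WF φ

  _[_/_] : Form → X → X → Form
  pr p z [ y / x ] = pr p (if eqX z x then y else z)
  ⊤' [ y / x ] = ⊤'
  ¬' φ [ y / x ] = ¬' (φ [ y / x ])
  (φ ∧' ψ) [ y / x ] = (φ [ y / x ]) ∧' (ψ [ y / x ])
  ([ z ≔ a ] φ) [ y / x ] = if eqX z x then [ z ≔ a ] φ else [ z ≔ a ] (φ [ y / x ])
  K xs α [ y / x ] = K (map (λ z → if eqX z x then y else z) xs) α

  admissible : X → X → Form → Bool
  admissible y x (pr p z) = true
  admissible y x ⊤' = true
  admissible y x (¬' φ) = admissible y x φ
  admissible y x (φ ∧' ψ) = admissible y x φ ∧ admissible y x ψ
  admissible y x ([ z ≔ b ] φ) =
    if eqX z x then true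
    else (if eqX z y then not (free x φ) else admissible y x φ)
  admissible y x (K xs α) = true

  -- propositional tautologies: true under every valuation of the
  -- non-Boolean subformulas (p_x, [x:=a]φ, K_X α) viewed as atoms
  eval : (Form → Bool) → Form → Bool
  eval v (pr p x) = v (pr p x)
  eval v ⊤' = true
  eval v (¬' φ) = not (eval v φ)
  eval v (φ ∧' ψ) = eval v φ ∧ eval v ψ
  eval v ([ x ≔ a ] φ) = v ([ x ≔ a ] φ)
  eval v (K xs α) = v (K xs α)

  Tautology : Form → Set
  Tautology φ = ∀ (v : Form → Bool) → eval v φ ≡ true

  allAgents : List Ag
  allAgents = Data.List.tabulate (λ a → a)

  complementAgents : List Ag → List Ag
  complementAgents as = filter (λ b → Relation.Nullary.Decidable.¬? (any? (b F.≟_) as)) allAgents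
    where import Relation.Nullary.Decidable

  data Axiom : Form → Set where
    taut   : ∀ {φ} → Tautology φ → Axiom φ
    kK     : ∀ xs α β → Axiom (K xs (α ⇒ β) ⇒ (K xs α ⇒ K xs β))
    kMono  : ∀ xs ys α → xs ⊆ ys → Axiom (K xs α ⇒ K ys α)
    aK     : ∀ x a φ ψ → Axiom ([ x ≔ a ] (φ ⇒ ψ) ⇒ ([ x ≔ a ] φ ⇒ [ x ≔ a ] ψ))
    aFunc  : ∀ x a φ → Axiom (⟨ x ≔ a ⟩ φ ⇒ [ x ≔ a ] φ)
    aVac   : ∀ x a φ → free x φ ≡ false → Axiom (φ ⇒ [ x ≔ a ] φ)
    aSubst : ∀ x y a φ → admissible y x φ ≡ true →
             Axiom ([ y ≔ a ] ([ x ≔ a ] φ ⇒ (φ [ y / x ])))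
    aComm  : ∀ x y a b φ → x ≢ y →
             Axiom ([ x ≔ a ] [ y ≔ b ] φ ⇒ [ y ≔ b ] [ x ≔ a ] φ)
    aAll   : ∀ x φ → Axiom (⋀ (map (λ a → [ x ≔ a ] φ) allAgents) ⇒ φ)
    kT     : ∀ xs α → Axiom (K xs α ⇒ α)
    kNeg   : ∀ (σ : List (X × Ag)) α →
             Axiom (assigns σ (¬' (K (vars σ) α) ⇒
                                K (vars σ) (assigns σ (¬' (K (vars σ) α)))))
    kDom   : ∀ x a → Axiom ([ x ≔ a ] K (x ∷ []) (⟨ x ≔ a ⟩ ⊤'))
    kPred  : ∀ x a p → Axiom ([ x ≔ a ] (pr p x ⇒ K (x ∷ []) ([ x ≔ a ] pr p x)))
    kBot   : ∀ (σ : List (X × Ag)) x →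
             let χ = ⋀ (map (λ b → [ x ≔ b ] ⊥') (complementAgents (agents σ))) in
             Axiom (assigns σ (χ ⇒ K (vars σ) χ))

  -- derivability in LEL^[:=]; axiom instances must be formulas of the
  -- language (well-formed)
  infix 2 ⊢_
  data ⊢_ : Form → Set where
    ax  : ∀ {φ} → Axiom φ → WF φ → ⊢ φ
    mp  : ∀ {φ ψ} → ⊢ φ → ⊢ (φ ⇒ ψ) → ⊢ ψ
    nec : ∀ {α} → Closed α → ⊢ α → ⊢ K [] α
    gen : ∀ {φ} x a → ⊢ φ → ⊢ [ x ≔ a ] φ

  data ANF : Form → Set where
    anfP : ∀ x a p → ANF ([ x ≔ a ] pr p x)
    anfB : ∀ x a → ANF ([ x ≔ a ] ⊥')
    anfT : ANF ⊤'
    anfN : ∀ {γ} → ANF γ → ANF (¬' γ)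
    anfC : ∀ {γ δ} → ANF γ → ANF δ → ANF (γ ∧' δ)
    anfK : ∀ (σ : List (X × Ag)) {γ} → ANF γ → ANF (assigns σ (K (vars σ) γ))

-- Normalise under an assignment prefix σ: every well-formed φ whose free
-- variables are all assigned by σ has a closed ANF formula γ with
-- ⊢ [σ](φ ↔ γ).  Under σ an atom p_x is equivalent to [x:=b]p_x, where b is the
-- value σ gives x last; [x:=a]φ is handled by extending σ with x:=a, since a
-- closed γ satisfies [x:=a]γ ↔ γ ∨ [x:=a]⊥; and K_X α becomes [τ]K_X γ, where γ
-- normalises the sentence α and τ lists the values σ gives to the variables
-- of X.  A sentence is the case of the empty prefix.
module Submission where

open import Defs
open import Data.Nat using (ℕ; zero; suc)
open import Data.Product using (Σ; _×_; _,_; proj₁; proj₂; uncurry)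
open import Function.Bundles using (_↣_; Equivalence)
open import Function using (case_of_)
open import Data.Fin using (Fin; zero; suc)
open import Data.Bool using (Bool; true; false; _∨_; _∧_; not; T; if_then_else_)
open import Data.Bool.Properties using (T-∧; T-≡; ∨-zeroʳ)
open import Data.Unit using (tt)
open import Data.List using (List; []; _∷_; _∷ʳ_)
open import Data.List.Properties using (map-++)
open import Data.List.Membership.Propositional using (_∈_; _∉_)
open import Data.List.Membership.Propositional.Properties using (∈-++⁺ˡ; ∈-++⁺ʳ)
open import Data.List.Relation.Unary.Any using (here; there)
open import Data.List.Relation.Unary.All using (All; []; _∷_)
open import Data.List.Relation.Binary.Subset.Propositional using (_⊆_)
open import Data.Vec as Vec using (Vec; []; _∷_)
open import Data.Vec.Properties using (lookup-map)
import Data.Vec.Relation.Unary.All as VecAll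
open VecAll using ([]; _∷_)
open import Data.Vec.Relation.Unary.All.Properties using (lookup⁺)
open import Relation.Nullary using (Dec; yes; no; does; contradiction)
open import Relation.Nullary.Decidable using (dec-true)
open import Relation.Binary.PropositionalEquality using (_≡_; refl; sym; trans; cong; cong₂; subst)

witness : ∀ {A : Set} (a? : Dec A) → does a? ≡ true → A
witness (yes a) _ = a

data Prop (n : ℕ) : Set where
  var  : Fin n → Prop n
  ⊤ₚ   : Prop n
  ¬ₚ_  : Prop n → Prop n
  _∧ₚ_ : Prop n → Prop n → Prop n

infixr 6 _∧ₚ_
infix 5 _⇔ₚ_
infixr 4 _⇒ₚ_

_⇒ₚ_ : ∀ {n} → Prop n → Prop n → Prop n
s ⇒ₚ t = ¬ₚ (s ∧ₚ ¬ₚ t)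

_⇔ₚ_ : ∀ {n} → Prop n → Prop n → Prop n
s ⇔ₚ t = (s ⇒ₚ t) ∧ₚ (t ⇒ₚ s)

v₀ : ∀ {n} → Prop (suc n)
v₀ = var zero

v₁ : ∀ {n} → Prop (suc (suc n))
v₁ = var (suc zero)

v₂ : ∀ {n} → Prop (suc (suc (suc n)))
v₂ = var (suc (suc zero))

v₃ : ∀ {n} → Prop (suc (suc (suc (suc n))))
v₃ = var (suc (suc (suc zero)))

evalₚ : ∀ {n} → Prop n → Vec Bool n → Bool
evalₚ (var i) β = Vec.lookup β i
evalₚ ⊤ₚ β = true
evalₚ (¬ₚ s) β = not (evalₚ s β)
evalₚ (s ∧ₚ t) β = evalₚ s β ∧ evalₚ t β

allValuations : ∀ n → (Vec Bool n → Bool) → Bool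
allValuations zero f = f []
allValuations (suc n) f =
  allValuations n (λ β → f (true ∷ β)) ∧ allValuations n (λ β → f (false ∷ β))

allValuations-sound : ∀ n f → T (allValuations n f) → ∀ β → T (f β)
allValuations-sound zero f t [] = t
allValuations-sound (suc n) f t (true ∷ β) =
  allValuations-sound n _ (proj₁ (Equivalence.to T-∧ t)) β
allValuations-sound (suc n) f t (false ∷ β) =
  allValuations-sound n _ (proj₂ (Equivalence.to (T-∧ {allValuations n (λ β → f (true ∷ β))}) t)) β

module Normalisation (nA : ℕ) (X : Set) (cX : X ↣ ℕ) (P : Set) (cP : P ↣ ℕ) where
  open Logic nA X cX P cP
  open import Data.List.Membership.DecPropositional _≟X_ using (_∈?_)

  private
    variable
      A B C φ χ θ : Form
      x y : X
      a b : Ag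
      σ τ : List (X × Ag)

  ⟦_⟧ : ∀ {n} → Prop n → Vec Form n → Form
  ⟦ var i ⟧ ρ = Vec.lookup ρ i
  ⟦ ⊤ₚ ⟧ ρ = ⊤'
  ⟦ ¬ₚ s ⟧ ρ = ¬' (⟦ s ⟧ ρ)
  ⟦ s ∧ₚ t ⟧ ρ = ⟦ s ⟧ ρ ∧' ⟦ t ⟧ ρ

  eval-⟦⟧ : ∀ {n} v (s : Prop n) ρ → eval v (⟦ s ⟧ ρ) ≡ evalₚ s (Vec.map (eval v) ρ)
  eval-⟦⟧ v (var i) ρ = sym (lookup-map i (eval v) ρ)
  eval-⟦⟧ v ⊤ₚ ρ = refl
  eval-⟦⟧ v (¬ₚ s) ρ = cong not (eval-⟦⟧ v s ρ)
  eval-⟦⟧ v (s ∧ₚ t) ρ = cong₂ _∧_ (eval-⟦⟧ v s ρ) (eval-⟦⟧ v t ρ)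

  wf-⟦⟧ : ∀ {n} (s : Prop n) {ρ} → VecAll.All WF ρ → WF (⟦ s ⟧ ρ)
  wf-⟦⟧ (var i) w = lookup⁺ w i
  wf-⟦⟧ ⊤ₚ w = tt
  wf-⟦⟧ (¬ₚ s) w = wf-⟦⟧ s w
  wf-⟦⟧ (s ∧ₚ t) w = wf-⟦⟧ s w , wf-⟦⟧ t w

  tautology : ∀ {n} (s : Prop n) (ρ : Vec Form n) {valid : T (allValuations n (evalₚ s))} →
              VecAll.All WF ρ → ⊢ ⟦ s ⟧ ρ
  tautology {n} s ρ {valid} w = ax (taut is-taut) (wf-⟦⟧ s w)
    where
    is-taut : Tautology (⟦ s ⟧ ρ)
    is-taut v = trans (eval-⟦⟧ v s ρ)
      (Equivalence.to T-≡ (allValuations-sound n (evalₚ s) valid (Vec.map (eval v) ρ)))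

  wf-derivable : ⊢ φ → WF φ
  wf-derivable (ax _ w) = w
  wf-derivable (mp _ d) = proj₂ (wf-derivable d)
  wf-derivable (nec c d) = c , wf-derivable d
  wf-derivable (gen _ _ d) = wf-derivable d

  ⇒-refl : WF A → ⊢ A ⇒ A
  ⇒-refl {A} w = tautology (v₀ ⇒ₚ v₀) (A ∷ []) (w ∷ [])

  ⇒-trans : ⊢ A ⇒ B → ⊢ B ⇒ C → ⊢ A ⇒ C
  ⇒-trans {A} {B} {C} d e = mp e (mp d (tautology
    ((v₀ ⇒ₚ v₁) ⇒ₚ (v₁ ⇒ₚ v₂) ⇒ₚ (v₀ ⇒ₚ v₂)) (A ∷ B ∷ C ∷ [])
    (wA ∷ wB ∷ wC ∷ [])))
    where
    wA : WF A
    wA = proj₁ (wf-derivable d)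
    wB : WF B
    wB = proj₂ (wf-derivable d)
    wC : WF C
    wC = proj₂ (wf-derivable e)

  ⇔-intro : ⊢ A ⇒ B → ⊢ B ⇒ A → ⊢ A ⇔ B
  ⇔-intro {A} {B} d e = mp e (mp d (tautology
    ((v₀ ⇒ₚ v₁) ⇒ₚ (v₁ ⇒ₚ v₀) ⇒ₚ (v₀ ⇔ₚ v₁)) (A ∷ B ∷ [])
    (proj₁ (wf-derivable d) ∷ proj₂ (wf-derivable d) ∷ [])))

  ⇔-to : ⊢ A ⇔ B → ⊢ A ⇒ B
  ⇔-to d = mp d (tautology ((v₀ ⇒ₚ v₁) ∧ₚ (v₁ ⇒ₚ v₀) ⇒ₚ (v₀ ⇒ₚ v₁)) (_ ∷ _ ∷ [])
    (proj₁ (proj₁ (wf-derivable d)) ∷ proj₂ (proj₁ (wf-derivable d)) ∷ []))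

  ⇔-from : ⊢ A ⇔ B → ⊢ B ⇒ A
  ⇔-from d = mp d (tautology ((v₀ ⇒ₚ v₁) ∧ₚ (v₁ ⇒ₚ v₀) ⇒ₚ (v₁ ⇒ₚ v₀)) (_ ∷ _ ∷ [])
    (proj₁ (proj₁ (wf-derivable d)) ∷ proj₂ (proj₁ (wf-derivable d)) ∷ []))

  wf-assigns : ∀ σ → WF φ → WF (assigns σ φ)
  wf-assigns [] w = w
  wf-assigns (_ ∷ σ) w = wf-assigns σ w

  wf-assigns⁻ : ∀ σ → WF (assigns σ φ) → WF φ
  wf-assigns⁻ [] w = w
  wf-assigns⁻ (_ ∷ σ) w = wf-assigns⁻ σ w

  wf-⇔-assigns : ∀ σ → ⊢ assigns σ (A ⇔ B) → WF A × WF B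
  wf-⇔-assigns σ d = proj₁ (wf-assigns⁻ σ (wf-derivable d))

  gen-assigns : ∀ σ → ⊢ φ → ⊢ assigns σ φ
  gen-assigns [] d = d
  gen-assigns ((x , a) ∷ σ) d = gen x a (gen-assigns σ d)

  assign-mono : ∀ x a → ⊢ A ⇒ B → ⊢ [ x ≔ a ] A ⇒ [ x ≔ a ] B
  assign-mono {A} {B} x a d = mp (gen x a d) (ax (aK x a A B) (w , w))
    where
    w : WF (A ⇒ B)
    w = wf-derivable d

  assigns-mono : ∀ σ → ⊢ A ⇒ B → ⊢ assigns σ A ⇒ assigns σ B
  assigns-mono [] d = d
  assigns-mono ((x , a) ∷ σ) d = assign-mono x a (assigns-mono σ d)

  assigns-distrib-⇒ : ∀ σ → WF A → WF B → ⊢ assigns σ (A ⇒ B) ⇒ (assigns σ A ⇒ assigns σ B)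
  assigns-distrib-⇒ [] wA wB = ⇒-refl (wA , wB)
  assigns-distrib-⇒ {A} {B} ((x , a) ∷ σ) wA wB =
    ⇒-trans (assign-mono x a (assigns-distrib-⇒ σ wA wB))
            (ax (aK x a (assigns σ A) (assigns σ B)) ((wA′ , wB′) , (wA′ , wB′)))
    where
    wA′ : WF (assigns σ A)
    wA′ = wf-assigns σ wA
    wB′ : WF (assigns σ B)
    wB′ = wf-assigns σ wB

  mp-assigns : ∀ σ → ⊢ assigns σ A → ⊢ A ⇒ B → ⊢ assigns σ B
  mp-assigns σ d t = mp d (assigns-mono σ t)

  mp₂-assigns : ∀ σ → ⊢ assigns σ A → ⊢ assigns σ B → ⊢ A ⇒ B ⇒ C → ⊢ assigns σ C
  mp₂-assigns {B = B} {C} σ dA dB t = mp dB (mp (mp-assigns σ dA t) (assigns-distrib-⇒ σ wB wC))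
    where
    wB : WF B
    wB = proj₁ (proj₂ (wf-derivable t))
    wC : WF C
    wC = proj₂ (proj₂ (wf-derivable t))

  ⇔-refl-assigns : ∀ σ → WF A → ⊢ assigns σ (A ⇔ A)
  ⇔-refl-assigns {A} σ w = gen-assigns σ (tautology (v₀ ⇔ₚ v₀) (A ∷ []) (w ∷ []))

  ⇔-trans-assigns : ∀ σ → ⊢ assigns σ (A ⇔ B) → ⊢ assigns σ (B ⇔ C) → ⊢ assigns σ (A ⇔ C)
  ⇔-trans-assigns {A} {B} {C} σ d e = mp₂-assigns σ d e (tautology
    ((v₀ ⇔ₚ v₁) ⇒ₚ (v₁ ⇔ₚ v₂) ⇒ₚ (v₀ ⇔ₚ v₂)) (A ∷ B ∷ C ∷ [])
    (proj₁ (wf-⇔-assigns σ d) ∷ proj₁ (wf-⇔-assigns σ e) ∷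
     proj₂ (wf-⇔-assigns σ e) ∷ []))

  ¬-cong-assigns : ∀ σ → ⊢ assigns σ (A ⇔ B) → ⊢ assigns σ (¬' A ⇔ ¬' B)
  ¬-cong-assigns {A} {B} σ d = mp-assigns σ d (tautology
    ((v₀ ⇔ₚ v₁) ⇒ₚ (¬ₚ v₀ ⇔ₚ ¬ₚ v₁)) (A ∷ B ∷ [])
    (proj₁ (wf-⇔-assigns σ d) ∷ proj₂ (wf-⇔-assigns σ d) ∷ []))

  ∧-cong-assigns : ∀ {D} σ → ⊢ assigns σ (A ⇔ B) → ⊢ assigns σ (C ⇔ D) →
                   ⊢ assigns σ ((A ∧' C) ⇔ (B ∧' D))
  ∧-cong-assigns {A} {B} {C} {D} σ d e = mp₂-assigns σ d e (tautology
    ((v₀ ⇔ₚ v₁) ⇒ₚ (v₂ ⇔ₚ v₃) ⇒ₚ ((v₀ ∧ₚ v₂) ⇔ₚ (v₁ ∧ₚ v₃))) (A ∷ B ∷ C ∷ D ∷ [])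
    (proj₁ (wf-⇔-assigns σ d) ∷ proj₂ (wf-⇔-assigns σ d) ∷
     proj₁ (wf-⇔-assigns σ e) ∷ proj₂ (wf-⇔-assigns σ e) ∷ []))

  assign-distrib-⇔ : ∀ x a → WF A → WF B → ⊢ [ x ≔ a ] (A ⇔ B) ⇒ (([ x ≔ a ] A) ⇔ ([ x ≔ a ] B))
  assign-distrib-⇔ {A} {B} x a wA wB = mp from (mp to (tautology
    ((v₀ ⇒ₚ v₁ ⇒ₚ v₂) ⇒ₚ (v₀ ⇒ₚ v₂ ⇒ₚ v₁) ⇒ₚ (v₀ ⇒ₚ (v₁ ⇔ₚ v₂)))
    ([ x ≔ a ] (A ⇔ B) ∷ [ x ≔ a ] A ∷ [ x ≔ a ] B ∷ [])
    (((wA , wB) , (wB , wA)) ∷ wA ∷ wB ∷ [])))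
    where
    wAB : VecAll.All WF (A ∷ B ∷ [])
    wAB = wA ∷ wB ∷ []
    to : ⊢ [ x ≔ a ] (A ⇔ B) ⇒ ([ x ≔ a ] A ⇒ [ x ≔ a ] B)
    to = ⇒-trans (assign-mono x a (tautology ((v₀ ⇔ₚ v₁) ⇒ₚ (v₀ ⇒ₚ v₁)) (A ∷ B ∷ []) wAB))
                 (assigns-distrib-⇒ ((x , a) ∷ []) wA wB)
    from : ⊢ [ x ≔ a ] (A ⇔ B) ⇒ ([ x ≔ a ] B ⇒ [ x ≔ a ] A)
    from = ⇒-trans (assign-mono x a (tautology ((v₀ ⇔ₚ v₁) ⇒ₚ (v₁ ⇒ₚ v₀)) (A ∷ B ∷ []) wAB))
                   (assigns-distrib-⇒ ((x , a) ∷ []) wB wA)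

  closed-∧ : Closed A → Closed B → Closed (A ∧' B)
  closed-∧ cA cB y = cong₂ _∨_ (cA y) (cB y)

  Covers : List (X × Ag) → Form → Set
  Covers σ φ = ∀ x → free x φ ≡ true → x ∈ vars σ

  closed⇒covers : ∀ φ → Closed φ → Covers [] φ
  closed⇒covers _ c x e = case trans (sym (c x)) e of λ ()

  free-assigns : ∀ τ y → (free y φ ≡ true → y ∈ vars τ) → free y (assigns τ φ) ≡ false
  free-assigns {φ} [] y cov with free y φ
  ... | true = case cov refl of λ ()
  ... | false = refl
  free-assigns ((x , a) ∷ τ) y cov with y ≟X x
  ... | yes _ = refl
  ... | no y≢x = free-assigns τ y λ e → case cov e of λ where
    (here y≡x) → contradiction y≡x y≢x
    (there y∈τ) → y∈τ

  closed-assigns : ∀ τ φ → Covers τ φ → Closed (assigns τ φ)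
  closed-assigns τ _ cov y = free-assigns τ y (cov y)

  covers-assign : ∀ σ → Covers σ ([ x ≔ a ] φ) → Covers (σ ∷ʳ (x , a)) φ
  covers-assign {x} {a} σ cov y e
    rewrite map-++ proj₁ σ ((x , a) ∷ [])
    with y ≟X x | cov y
  ... | yes refl | _ = ∈-++⁺ʳ (vars σ) (here refl)
  ... | no _ | cov-y = ∈-++⁺ˡ (cov-y e)

  assigns-∷ʳ : ∀ σ φ → assigns (σ ∷ʳ (x , a)) φ ≡ assigns σ ([ x ≔ a ] φ)
  assigns-∷ʳ [] φ = refl
  assigns-∷ʳ ((y , b) ∷ σ) φ = cong ([ y ≔ b ]_) (assigns-∷ʳ σ φ)

  [/]-self : ∀ y χ → χ [ y / y ] ≡ χ
  [/]-self y (pr p z) with z ≟X y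
  ... | yes refl = refl
  ... | no _ = refl
  [/]-self y ⊤' = refl
  [/]-self y (¬' χ) = cong ¬' ([/]-self y χ)
  [/]-self y (χ ∧' ψ) = cong₂ _∧'_ ([/]-self y χ) ([/]-self y ψ)
  [/]-self y ([ z ≔ a ] χ) with z ≟X y
  ... | yes _ = refl
  ... | no _ = cong ([ z ≔ a ]_) ([/]-self y χ)
  [/]-self y (K xs α) = cong (λ ys → K ys α) (rename-self xs)
    where
    rename-self : ∀ xs → Data.List.map (λ z → if does (z ≟X y) then y else z) xs ≡ xs
    rename-self [] = refl
    rename-self (z ∷ xs) with z ≟X y
    ... | yes refl = cong (y ∷_) (rename-self xs)
    ... | no _ = cong (z ∷_) (rename-self xs)

  admissible-self : ∀ y χ → admissible y y χ ≡ true
  admissible-self y (pr p z) = refl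
  admissible-self y ⊤' = refl
  admissible-self y (¬' χ) = admissible-self y χ
  admissible-self y (χ ∧' ψ) = cong₂ _∧_ (admissible-self y χ) (admissible-self y ψ)
  admissible-self y ([ z ≔ a ] χ) with z ≟X y
  ... | yes _ = refl
  ... | no _ = admissible-self y χ
  admissible-self y (K xs α) = refl

  assign-assign-elim : ∀ y b → WF χ → ⊢ [ y ≔ b ] ([ y ≔ b ] χ ⇒ χ)
  assign-assign-elim {χ} y b w =
    subst (λ θ → ⊢ [ y ≔ b ] ([ y ≔ b ] χ ⇒ θ)) ([/]-self y χ)
      (ax (aSubst y y b χ (admissible-self y χ)) (w , subst WF (sym ([/]-self y χ)) w))

  ¬-assign⇒assign-¬ : ∀ y b → WF χ → ⊢ ¬' ([ y ≔ b ] χ) ⇒ [ y ≔ b ] ¬' χ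
  ¬-assign⇒assign-¬ {χ} y b w = ⇒-trans contra (ax (aFunc y b (¬' χ)) (w , w))
    where
    contra : ⊢ ¬' ([ y ≔ b ] χ) ⇒ ¬' ([ y ≔ b ] ¬' (¬' χ))
    contra = mp (assign-mono y b (tautology (¬ₚ ¬ₚ v₀ ⇒ₚ v₀) (χ ∷ []) (w ∷ [])))
      (tautology ((v₀ ⇒ₚ v₁) ⇒ₚ (¬ₚ v₁ ⇒ₚ ¬ₚ v₀))
        ([ y ≔ b ] ¬' (¬' χ) ∷ [ y ≔ b ] χ ∷ []) (w ∷ w ∷ []))

  assign-reassign : ∀ y b → WF χ → ⊢ [ y ≔ b ] (χ ⇔ ([ y ≔ b ] χ))
  assign-reassign {χ} y b w = mp₂-assigns ((y , b) ∷ []) intro (assign-assign-elim y b w) (tautology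
    ((v₀ ⇒ₚ v₁) ⇒ₚ (v₁ ⇒ₚ v₀) ⇒ₚ (v₀ ⇔ₚ v₁)) (χ ∷ [ y ≔ b ] χ ∷ []) (w ∷ w ∷ []))
    where
    intro : ⊢ [ y ≔ b ] (χ ⇒ [ y ≔ b ] χ)
    intro = mp₂-assigns ((y , b) ∷ []) (gen y b (¬-assign⇒assign-¬ y b w)) (assign-assign-elim y b w)
      (tautology ((¬ₚ v₀ ⇒ₚ v₁) ⇒ₚ (v₁ ⇒ₚ ¬ₚ v₂) ⇒ₚ (v₂ ⇒ₚ v₀))
        ([ y ≔ b ] χ ∷ [ y ≔ b ] ¬' χ ∷ χ ∷ []) (w ∷ w ∷ w ∷ []))

  assigns-comm-assign : ∀ ρ → y ∉ vars ρ → WF θ → ⊢ assigns ρ ([ y ≔ b ] θ) ⇒ [ y ≔ b ] assigns ρ θ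
  assigns-comm-assign [] _ w = ⇒-refl w
  assigns-comm-assign {y} {θ} {b} ((z , c) ∷ ρ) y∉ w =
    ⇒-trans (assign-mono z c (assigns-comm-assign ρ (λ m → y∉ (there m)) w))
            (ax (aComm z y c b (assigns ρ θ) (λ z≡y → y∉ (here (sym z≡y)))) (w′ , w′))
    where
    w′ : WF (assigns ρ θ)
    w′ = wf-assigns ρ w

  -- assigns σ puts the head of σ outermost, so the value of y in effect
  -- under σ is the one of the last pair for y.
  data Binds : List (X × Ag) → X → Ag → Set where
    final : ∀ {ρ y b} → y ∉ vars ρ → Binds ((y , b) ∷ ρ) y b
    skip  : ∀ {ρ y b z c} → Binds ρ y b → Binds ((z , c) ∷ ρ) y b

  binding : ∀ σ y → y ∈ vars σ → Σ Ag (Binds σ y)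
  binding ((z , c) ∷ ρ) y y∈ with y ∈? vars ρ
  ... | yes y∈ρ = let (b , l) = binding ρ y y∈ρ in b , skip l
  ... | no y∉ρ with y∈
  ...   | here refl = c , final y∉ρ
  ...   | there y∈ρ = contradiction y∈ρ y∉ρ

  restriction : ∀ σ xs → xs ⊆ vars σ →
                Σ (List (X × Ag)) λ τ → vars τ ≡ xs × All (uncurry (Binds σ)) τ
  restriction σ [] _ = [] , refl , []
  restriction σ (x ∷ xs) sub
    with binding σ x (sub (here refl)) | restriction σ xs (λ m → sub (there m))
  ... | b , l | τ , refl , ls = (x , b) ∷ τ , refl , l ∷ ls

  assigns-rebind : Binds σ y b → WF χ → ⊢ assigns σ (χ ⇔ ([ y ≔ b ] χ))
  assigns-rebind {y = y} {b} {χ} (final {ρ} y∉ρ) w =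
    mp (gen-assigns ρ (assign-reassign y b w)) (assigns-comm-assign ρ y∉ρ ((w , w) , (w , w)))
  assigns-rebind (skip {z = z} {c} l) w = gen z c (assigns-rebind l w)

  assigns-rebind-all : All (uncurry (Binds σ)) τ → WF φ → ⊢ assigns σ (φ ⇔ assigns τ φ)
  assigns-rebind-all {σ} [] w = ⇔-refl-assigns σ w
  assigns-rebind-all {σ} {_ ∷ τ} (l ∷ ls) w =
    ⇔-trans-assigns σ (assigns-rebind-all ls w) (assigns-rebind l (wf-assigns τ w))

  infixr 5 _∨'_
  _∨'_ : Form → Form → Form
  A ∨' B = ¬' (¬' A ∧' ¬' B)

  -- aVac puts both A and ¬A under [x:=a], so [x:=a]A can only fail together
  -- with A, and holds without A only if x:=a is impossible.
  assign-closed : ∀ x a → Closed A → WF A → ⊢ ([ x ≔ a ] A) ⇔ (A ∨' [ x ≔ a ] ⊥')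
  assign-closed {A} x a c w = mp exfalso (mp clash (mp intro (mp keep (tautology
    ((¬ₚ v₀ ⇒ₚ v₂) ⇒ₚ (v₀ ⇒ₚ v₁) ⇒ₚ (v₁ ⇒ₚ v₂ ⇒ₚ v₃) ⇒ₚ (v₃ ⇒ₚ v₁) ⇒ₚ (v₁ ⇔ₚ ¬ₚ (¬ₚ v₀ ∧ₚ ¬ₚ v₃)))
    (A ∷ [ x ≔ a ] A ∷ [ x ≔ a ] ¬' A ∷ [ x ≔ a ] ⊥' ∷ [])
    (w ∷ w ∷ w ∷ tt ∷ [])))))
    where
    keep : ⊢ ¬' A ⇒ [ x ≔ a ] ¬' A
    keep = ax (aVac x a (¬' A) (c x)) (w , w)
    intro : ⊢ A ⇒ [ x ≔ a ] A
    intro = ax (aVac x a A (c x)) (w , w)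
    clash : ⊢ [ x ≔ a ] A ⇒ ([ x ≔ a ] ¬' A ⇒ [ x ≔ a ] ⊥')
    clash = ⇒-trans (assign-mono x a (tautology (v₀ ⇒ₚ ¬ₚ v₀ ⇒ₚ ¬ₚ ⊤ₚ) (A ∷ []) (w ∷ [])))
                    (ax (aK x a (¬' A) ⊥') ((w , tt) , (w , tt)))
    exfalso : ⊢ [ x ≔ a ] ⊥' ⇒ [ x ≔ a ] A
    exfalso = assign-mono x a (tautology (¬ₚ ⊤ₚ ⇒ₚ v₀) (A ∷ []) (w ∷ []))

  K-mono : ∀ xs → Closed A → Closed B → ⊢ A ⇒ B → ⊢ K xs A ⇒ K xs B
  K-mono {A} {B} xs cA cB d =
    mp (mp K∅ (ax (kMono [] xs (A ⇒ B) (λ ())) (wK , wK))) (ax (kK xs A B) (wK , (cA , wA) , (cB , wB)))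
    where
    K∅ : ⊢ K [] (A ⇒ B)
    K∅ = nec (closed-∧ {A} {¬' B} cA cB) d
    wK : WF (K [] (A ⇒ B))
    wK = wf-derivable K∅
    wA : WF A
    wA = proj₁ (wf-derivable d)
    wB : WF B
    wB = proj₂ (wf-derivable d)

  K-cong : ∀ xs → Closed A → Closed B → ⊢ A ⇔ B → ⊢ K xs A ⇔ K xs B
  K-cong xs cA cB d = ⇔-intro (K-mono xs cA cB (⇔-to d)) (K-mono xs cB cA (⇔-from d))

  NormalForm : List (X × Ag) → Form → Set
  NormalForm σ φ = Σ Form λ γ → ANF γ × WF γ × Closed γ × (⊢ assigns σ (φ ⇔ γ))

  normal-form-pred : ∀ p → Binds σ x b → NormalForm σ (pr p x)
  normal-form-pred {x = x} {b} p l =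
    [ x ≔ b ] pr p x , anfP x b p , tt , closed-assigns ((x , b) ∷ []) (pr p x) cov , assigns-rebind l tt
    where
    cov : Covers ((x , b) ∷ []) (pr p x)
    cov y e = here (witness (y ≟X x) e)

  normal-form-¬ : ∀ σ → NormalForm σ φ → NormalForm σ (¬' φ)
  normal-form-¬ σ (γ , anf , wγ , cγ , φ⇔γ) = ¬' γ , anfN anf , wγ , cγ , ¬-cong-assigns σ φ⇔γ

  normal-form-∧ : ∀ σ → NormalForm σ A → NormalForm σ B → NormalForm σ (A ∧' B)
  normal-form-∧ σ (γ , anf , wγ , cγ , A⇔γ) (δ , anf′ , wδ , cδ , B⇔δ) =
    γ ∧' δ , anfC anf anf′ , (wγ , wδ) , closed-∧ {γ} {δ} cγ cδ , ∧-cong-assigns σ A⇔γ B⇔δ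

  normal-form-assign : ∀ σ → NormalForm (σ ∷ʳ (x , a)) φ → NormalForm σ ([ x ≔ a ] φ)
  normal-form-assign {x} {a} {φ} σ (γ , anf , wγ , cγ , φ⇔γ) =
    γ ∨' [ x ≔ a ] ⊥' , anfN (anfC (anfN anf) (anfN (anfB x a))) , (wγ , tt) ,
    closed-∧ {¬' γ} {¬' ([ x ≔ a ] ⊥')} cγ (closed-assigns ((x , a) ∷ []) ⊥' λ _ ()) ,
    ⇔-trans-assigns σ
      (mp-assigns σ (subst ⊢_ (assigns-∷ʳ σ (φ ⇔ γ)) φ⇔γ) (assign-distrib-⇔ x a wφ wγ))
      (gen-assigns σ (assign-closed x a cγ wγ))
    where
    wφ : WF φ
    wφ = proj₁ (wf-⇔-assigns (σ ∷ʳ (x , a)) φ⇔γ)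

  normal-form-K : ∀ σ {xs α} → Closed α → NormalForm [] α → xs ⊆ vars σ → NormalForm σ (K xs α)
  normal-form-K σ {xs} cα (γ , anf , wγ , cγ , α⇔γ) xs⊆σ with restriction σ xs xs⊆σ
  ... | τ , refl , binds =
    assigns τ (K (vars τ) γ) , anfK τ anf , wf-assigns τ (cγ , wγ) ,
    closed-assigns τ (K (vars τ) γ) (λ y e → witness (y ∈? vars τ) e) ,
    ⇔-trans-assigns σ (gen-assigns σ (K-cong xs cα cγ α⇔γ)) (assigns-rebind-all binds (cγ , wγ))

  normalise : ∀ φ → WF φ → ∀ σ → Covers σ φ → NormalForm σ φ
  normalise (pr p x) _ σ cov = normal-form-pred p (proj₂ (binding σ x (cov x (dec-true (x ≟X x) refl))))
  normalise ⊤' _ σ _ = ⊤' , anfT , tt , (λ _ → refl) , ⇔-refl-assigns σ tt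
  normalise (¬' φ) w σ cov = normal-form-¬ σ (normalise φ w σ cov)
  normalise (φ ∧' ψ) (w , w′) σ cov = normal-form-∧ σ
    (normalise φ w σ (λ x e → cov x (cong (_∨ free x ψ) e)))
    (normalise ψ w′ σ (λ x e → cov x (trans (cong (free x φ ∨_) e) (∨-zeroʳ (free x φ)))))
  normalise ([ x ≔ a ] φ) w σ cov = normal-form-assign σ (normalise φ w (σ ∷ʳ (x , a)) (covers-assign {φ = φ} σ cov))
  normalise (K xs α) (cα , wα) σ cov =
    normal-form-K σ cα (normalise α wα [] (closed⇒covers α cα)) (λ m → cov _ (dec-true (_ ∈? xs) m))

mainTheorem10 : (nA : ℕ) (X : Set) (cX : X ↣ ℕ) (P : Set) (cP : P ↣ ℕ) →
    let open Logic nA X cX P cP in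
    (α : Form) → Sentence α →
    Σ Form (λ γ → ANF γ × WF γ × (⊢ (α ⇔ γ)))
mainTheorem10 nA X cX P cP α (cα , wα) =
  let (γ , anf , wγ , _ , α⇔γ) = normalise α wα [] (closed⇒covers α cα) in γ , anf , wγ , α⇔γ
  where open Normalisation nA X cX P cP
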